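{- Let $x$ be a Hall number, and suppose $x^{3/2} = y + f$ or $x^{3/2} = y - f$, where $y$ is a positive integer and $0 < f < 0.5$. Then $2fx < 1 + \frac{1}{4\sqrt{x}}$.
   Context: For a positive integer $x$ that is not a perfect square, let $k_x$ denote the distance between $x^3$ and the perfect square (square of an integer) closest to $x^3$, and let $r_x = \sqrt{x}/k_x$. A Hall number is a positive integer $x$ that is not a perfect square and satisfies $r_x > 1$. -}

module Defs where

open import Data.Nat as ℕ using (ℕ; ∣_-_∣; NonZero)
open import Data.Integer using (+_)
open import Data.Rational as ℚ using (ℚ; 0ℚ; 1ℚ; ½; 1/_; ≢-nonZero)
open import Data.Rational.Properties using (_≟_)
open import Data.Product using (Σ; ∃; _×_; _,_)
open import Data.Sum using (_⊎_)
open import Relation.Nullary using (¬_; yes; no)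
open import Relation.Binary.PropositionalEquality using (_≡_)

IsSquare : ℕ → Set
IsSquare x = ∃ λ n → n ℕ.* n ≡ x

IsDistToNearestSquare : ℕ → ℕ → Set
IsDistToNearestSquare x k =
  (∃ λ n → ∣ x ℕ.^ 3 - n ℕ.* n ∣ ≡ k) × (∀ m → k ℕ.≤ ∣ x ℕ.^ 3 - m ℕ.* m ∣)

-- r_x = √x / k_x > 1, with k_x ≥ 0, is equivalent to k_x² < x
-- (no real numbers are available).
IsHall : ℕ → Set
IsHall x = NonZero x × ¬ IsSquare x ×
  (∃ λ k → IsDistToNearestSquare x k × k ℕ.* k ℕ.< x)

-- The field ℚ(√d): an element (a , b) stands for the real a + b√d.
-- For d a positive non-square this is a subfield of ℝ, and the order
-- below is the order inherited from ℝ.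

infix 1 _,√_
record Q√ (d : ℕ) : Set where
  constructor _,√_
  field
    re : ℚ
    im : ℚ

module _ {d : ℕ} where

  nat : ℕ → Q√ d
  nat n = (+ n ℚ./ 1 ,√ 0ℚ)

  rat : ℚ → Q√ d
  rat q = (q ,√ 0ℚ)

  √d : Q√ d
  √d = (0ℚ ,√ 1ℚ)

  infixl 6 _⊕_ _⊖_
  infixl 7 _⊗_
  infix 4 _≺_

  _⊕_ : Q√ d → Q√ d → Q√ d
  (a ,√ b) ⊕ (c ,√ e) = (a ℚ.+ c ,√ b ℚ.+ e)

  _⊖_ : Q√ d → Q√ d → Q√ d
  (a ,√ b) ⊖ (c ,√ e) = (a ℚ.- c ,√ b ℚ.- e)

  _⊗_ : Q√ d → Q√ d → Q√ d
  (a ,√ b) ⊗ (c ,√ e) =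
    (a ℚ.* c ℚ.+ b ℚ.* e ℚ.* (+ d ℚ./ 1) ,√ a ℚ.* e ℚ.+ b ℚ.* c)

  -- reciprocal: 1/(a + b√d) = (a - b√d)/(a² - d b²); (0 ↦ 0 by convention,
  -- never used on 0 below)
  recip : Q√ d → Q√ d
  recip (a ,√ b) with a ℚ.* a ℚ.- b ℚ.* b ℚ.* (+ d ℚ./ 1) ≟ 0ℚ
  ... | yes _ = (0ℚ ,√ 0ℚ)
  ... | no N≢0 = let instance _ = ≢-nonZero N≢0
                     iN = 1/ (a ℚ.* a ℚ.- b ℚ.* b ℚ.* (+ d ℚ./ 1))
                 in (a ℚ.* iN ,√ ℚ.- (b ℚ.* iN))

  Positive : Q√ d → Set
  Positive (a ,√ b) =
      (0ℚ ℚ.≤ a × 0ℚ ℚ.≤ b × (0ℚ ℚ.< a ⊎ 0ℚ ℚ.< b))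
    ⊎ (0ℚ ℚ.< a × b ℚ.< 0ℚ × b ℚ.* b ℚ.* (+ d ℚ./ 1) ℚ.< a ℚ.* a)
    ⊎ (a ℚ.< 0ℚ × 0ℚ ℚ.< b × a ℚ.* a ℚ.< b ℚ.* b ℚ.* (+ d ℚ./ 1))

  _≺_ : Q√ d → Q√ d → Set
  u ≺ v = Positive (v ⊖ u)

-- Put m = ∣x³ - y²∣. The conditions 0 < f < ½ say that x√x lies within ½ of y, i.e. that x³
-- lies strictly between (y - ½)² and (y + ½)²; hence y² is a square nearest to x³ and m is at
-- most the distance k_x, so m² < x. Together with x³ ≤ y² + m this gives (m x)² + x² ≤ x³ ≤
-- y² + x², i.e. m x ≤ y. The claim 2fx < 1 + 1/(4√x) is a sign condition on an element
-- a + b√x of ℚ(√x); after scaling by (4x)² to clear 1/(4x) it becomes a polynomial inequality in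
-- x and y of degree 7, which follows from y² = x³ ∓ m and m x ≤ y.
module Submission where

open import Defs
open import Data.Nat using (ℕ)
open import Data.Product using (_×_; _,_; ∃; proj₁)
open import Data.Sum using (_⊎_; inj₁; inj₂)
open import Data.Empty using (⊥-elim)
open import Relation.Nullary using (yes; no)
open import Relation.Binary.PropositionalEquality

module HallBounds where

  open import Data.Nat
  open import Data.Nat.Properties
  open import Data.Nat.Solver using (module +-*-Solver)
  open +-*-Solver using (solve; _:+_; _:*_; _:=_; con)
  open ≤-Reasoning

  m+n≤o⇒n≤∣o-m∣ : ∀ {m n o} → m + n ≤ o → n ≤ ∣ o - m ∣
  m+n≤o⇒n≤∣o-m∣ {m} {n} {o} m+n≤o =
    ≤-trans (m+n≤o⇒m≤o∸n n (subst (_≤ o) (+-comm m n) m+n≤o)) (m∸n≤∣m-n∣ o m)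

  m+n≤o⇒n≤∣m-o∣ : ∀ {m n o} → m + n ≤ o → n ≤ ∣ m - o ∣
  m+n≤o⇒n≤∣m-o∣ {m} {n} {o} m+n≤o = subst (n ≤_) (∣-∣-comm o m) (m+n≤o⇒n≤∣o-m∣ m+n≤o)

  square-cancel-≤ : ∀ {m n} → m * m ≤ n * n → m ≤ n
  square-cancel-≤ m²≤n² = ≮⇒≥ (λ n<m → <⇒≱ (*-mono-< n<m n<m) m²≤n²)

  m*m<n⇒m≤n*n : ∀ m {n} → m * m < n → m ≤ n * n
  m*m<n⇒m≤n*n zero      _    = z≤n
  m*m<n⇒m≤n*n m@(suc _) {n} m²<n =
    ≤-trans (m≤m*n m m) (≤-trans (<⇒≤ m²<n) (m≤m*n n n {{>-nonZero (≤-<-trans z≤n m²<n)}}))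

  x^3≡x*x*x : ∀ x → x ^ 3 ≡ x * x * x
  x^3≡x*x*x x = solve 1 (λ x → x :* (x :* (x :* con 1)) := x :* x :* x) refl x

  1<8*x³ : ∀ x → .{{NonZero x}} → 1 < 8 * (x * x * x)
  1<8*x³ x@(suc _) = ≤-trans (s≤s (s≤s z≤n)) (m≤m*n 8 (x * x * x))

  nearest-square-above : ∀ {N y m} → y * y + m ≡ N → m ≤ y → ∀ n → m ≤ ∣ N - n * n ∣
  nearest-square-above {N} {y} {m} y²+m≡N m≤y n with n ≤? y
  ... | yes n≤y = m+n≤o⇒n≤∣o-m∣ (subst (n * n + m ≤_) y²+m≡N (+-monoˡ-≤ m (*-mono-≤ n≤y n≤y)))
  ... | no n≰y = m+n≤o⇒n≤∣m-o∣ (begin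
    N + m               ≡⟨ cong (_+ m) y²+m≡N ⟨
    y * y + m + m       ≤⟨ +-mono-≤ (+-monoʳ-≤ (y * y) m≤y) m≤y ⟩
    y * y + y + y       ≤⟨ n≤1+n _ ⟩
    suc (y * y + y + y) ≡⟨ solve 1 (λ y → con 1 :+ (y :* y :+ y :+ y) := (con 1 :+ y) :* (con 1 :+ y)) refl y ⟩
    suc y * suc y       ≤⟨ *-mono-≤ (≰⇒> n≰y) (≰⇒> n≰y) ⟩
    n * n               ∎)

  nearest-square-below : ∀ {N y m} → N + m ≡ y * y → m < y → ∀ n → m ≤ ∣ N - n * n ∣
  nearest-square-below {N} {y} {m} N+m≡y² m<y n with y ≤? n
  ... | yes y≤n = m+n≤o⇒n≤∣m-o∣ (subst (_≤ n * n) (sym N+m≡y²) (*-mono-≤ y≤n y≤n))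
  nearest-square-below {N} {suc z} {m} N+m≡y² (s≤s m≤z) n | no y≰n =
    m+n≤o⇒n≤∣o-m∣ (+-cancelʳ-≤ m (n * n + m) N (begin
    n * n + m + m       ≤⟨ +-mono-≤ (+-mono-≤ (*-mono-≤ n≤z n≤z) m≤z) m≤z ⟩
    z * z + z + z       ≤⟨ n≤1+n _ ⟩
    suc (z * z + z + z) ≡⟨ solve 1 (λ z → con 1 :+ (z :* z :+ z :+ z) := (con 1 :+ z) :* (con 1 :+ z)) refl z ⟩
    suc z * suc z       ≡⟨ N+m≡y² ⟨
    N + m               ∎))
    where
    n≤z : n ≤ z
    n≤z = ≤-pred (≰⇒> y≰n)

  gap≤-of-<[y+½]² : ∀ {N y m} → y * y + m ≡ N → 4 * N < (1 + 2 * y) * (1 + 2 * y) → m ≤ y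
  gap≤-of-<[y+½]² {N} {y} {m} y²+m≡N 4N<[1+2y]² =
    *-cancelˡ-≤ 4 (≤-pred (+-cancelˡ-< (4 * (y * y)) _ _ (begin-strict
    4 * (y * y) + 4 * m       ≡⟨ *-distribˡ-+ 4 (y * y) m ⟨
    4 * (y * y + m)           ≡⟨ cong (4 *_) y²+m≡N ⟩
    4 * N                     <⟨ 4N<[1+2y]² ⟩
    (1 + 2 * y) * (1 + 2 * y) ≡⟨ solve 1 (λ y → (con 1 :+ con 2 :* y) :* (con 1 :+ con 2 :* y)
                                             := con 4 :* (y :* y) :+ (con 1 :+ con 4 :* y)) refl y ⟩
    4 * (y * y) + suc (4 * y) ∎)))

  gap<-of->[y-½]² : ∀ {N y m} → N + m ≡ y * y → 4 * (y * y) + 1 < 4 * N + 4 * y → m < y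
  gap<-of->[y-½]² {N} {y} {m} N+m≡y² 4y²+1<4N+4y = *-cancelˡ-< 4 m y (+-cancelˡ-< (4 * N) _ _ (begin-strict
    4 * N + 4 * m   ≡⟨ *-distribˡ-+ 4 N m ⟨
    4 * (N + m)     ≡⟨ cong (4 *_) N+m≡y² ⟩
    4 * (y * y)     ≤⟨ m≤m+n _ 1 ⟩
    4 * (y * y) + 1 <⟨ 4y²+1<4N+4y ⟩
    4 * N + 4 * y   ∎))

  sq<∧cube≤⇒m*x≤y : ∀ {x y m} → m * m < x → x * x * x ≤ y * y + m → m * x ≤ y
  sq<∧cube≤⇒m*x≤y {x} {y} {m} m²<x x³≤y²+m = square-cancel-≤ (+-cancelʳ-≤ (x * x) _ _ (begin
    m * x * (m * x) + x * x ≡⟨ solve 2 (λ m x → m :* x :* (m :* x) :+ x :* x := (con 1 :+ m :* m) :* (x :* x)) refl m x ⟩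
    suc (m * m) * (x * x)   ≤⟨ *-monoˡ-≤ (x * x) m²<x ⟩
    x * (x * x)             ≡⟨ *-assoc x x x ⟨
    x * x * x               ≤⟨ x³≤y²+m ⟩
    y * y + m               ≤⟨ +-monoʳ-≤ (y * y) (m*m<n⇒m≤n*n m m²<x) ⟩
    y * y + x * x           ∎))

  Hall⇒m*m<x : ∀ {x m} → IsHall x → (∀ n → m ≤ ∣ x ^ 3 - n * n ∣) → m * m < x
  Hall⇒m*m<x {m = m} (_ , _ , k , ((n , dist≡k) , _) , k²<x) m≤dist = ≤-<-trans (*-mono-≤ m≤k m≤k) k²<x
    where
    m≤k : m ≤ k
    m≤k = subst (m ≤_) dist≡k (m≤dist n)

  bound-y²+m≡x³ : ∀ {x y m} → .{{NonZero x}} → y * y + m ≡ x * x * x → m * x ≤ y →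
    x + 64 * (x * x * (x * x)) * (x * x * x)
      < 16 * (x * x) * ((1 + 2 * x * y) * (1 + 2 * x * y)) + 16 * (x * x * (x * x))
  bound-y²+m≡x³ {x} {y} {m} y²+m≡x³ mx≤y = begin-strict
    x + 64 * (x * x * (x * x)) * (x * x * x)
      ≡⟨ cong (λ c → x + 64 * (x * x * (x * x)) * c) y²+m≡x³ ⟨
    x + 64 * (x * x * (x * x)) * (y * y + m)
      ≡⟨ solve 3 (λ x y m → x :+ con 64 :* (x :* x :* (x :* x)) :* (y :* y :+ m)
                         := x :+ con 64 :* (x :* x :* (x :* x)) :* (y :* y) :+ con 64 :* (x :* x :* x) :* (m :* x)) refl x y m ⟩
    x + 64 * (x * x * (x * x)) * (y * y) + 64 * (x * x * x) * (m * x)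
      ≤⟨ +-monoʳ-≤ _ (*-monoʳ-≤ (64 * (x * x * x)) mx≤y) ⟩
    x + 64 * (x * x * (x * x)) * (y * y) + 64 * (x * x * x) * y
      <⟨ +-monoˡ-< _ (+-monoˡ-< _ (x<16x²+16x⁴ x)) ⟩
    16 * (x * x) + 16 * (x * x * (x * x)) + 64 * (x * x * (x * x)) * (y * y) + 64 * (x * x * x) * y
      ≡⟨ solve 2 (λ x y → con 16 :* (x :* x) :+ con 16 :* (x :* x :* (x :* x)) :+ con 64 :* (x :* x :* (x :* x)) :* (y :* y) :+ con 64 :* (x :* x :* x) :* y
                       := con 16 :* (x :* x) :* ((con 1 :+ con 2 :* x :* y) :* (con 1 :+ con 2 :* x :* y)) :+ con 16 :* (x :* x :* (x :* x))) refl x y ⟩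
    16 * (x * x) * ((1 + 2 * x * y) * (1 + 2 * x * y)) + 16 * (x * x * (x * x)) ∎
    where
    x<16x²+16x⁴ : ∀ x → .{{NonZero x}} → x < 16 * (x * x) + 16 * (x * x * (x * x))
    x<16x²+16x⁴ x@(suc _) = begin-strict
      x                                     ≤⟨ m≤m*n x x ⟩
      x * x                                 ≤⟨ m≤n*m (x * x) 16 ⟩
      16 * (x * x)                          <⟨ m<m+n _ z<s ⟩
      16 * (x * x) + 16 * (x * x * (x * x)) ∎

  bound-x³+m≡y² : ∀ {x y m} → .{{NonZero x}} → x * x * x + m ≡ y * y → m * x ≤ y →
    16 * (x * x) + 64 * (x * x * (x * x)) * (y * y)
      < x + 16 * (x * x * (x * x)) + 64 * (x * x * (x * x)) * (x * x * x) + 64 * (x * x * x) * y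
  bound-x³+m≡y² {x} {y} {m} x³+m≡y² mx≤y = begin-strict
    16 * (x * x) + 64 * (x * x * (x * x)) * (y * y)
      ≡⟨ cong (λ c → 16 * (x * x) + 64 * (x * x * (x * x)) * c) x³+m≡y² ⟨
    16 * (x * x) + 64 * (x * x * (x * x)) * (x * x * x + m)
      ≡⟨ solve 2 (λ x m → con 16 :* (x :* x) :+ con 64 :* (x :* x :* (x :* x)) :* (x :* x :* x :+ m)
                       := con 16 :* (x :* x) :+ con 64 :* (x :* x :* (x :* x)) :* (x :* x :* x) :+ con 64 :* (x :* x :* x) :* (m :* x)) refl x m ⟩
    16 * (x * x) + 64 * (x * x * (x * x)) * (x * x * x) + 64 * (x * x * x) * (m * x)
      ≤⟨ +-monoʳ-≤ _ (*-monoʳ-≤ (64 * (x * x * x)) mx≤y) ⟩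
    16 * (x * x) + 64 * (x * x * (x * x)) * (x * x * x) + 64 * (x * x * x) * y
      <⟨ +-monoˡ-< _ (+-monoˡ-< _ (16x²<x+16x⁴ x)) ⟩
    x + 16 * (x * x * (x * x)) + 64 * (x * x * (x * x)) * (x * x * x) + 64 * (x * x * x) * y ∎
    where
    16x²<x+16x⁴ : ∀ x → .{{NonZero x}} → 16 * (x * x) < x + 16 * (x * x * (x * x))
    16x²<x+16x⁴ x@(suc _) = begin-strict
      16 * (x * x)               ≤⟨ *-monoʳ-≤ 16 (m≤m*n (x * x) (x * x)) ⟩
      16 * (x * x * (x * x))     <⟨ m<n+m _ z<s ⟩
      x + 16 * (x * x * (x * x)) ∎

  Hall-bound-y²≤x³ : ∀ {x y} → IsHall x → y * y ≤ x * x * x → 4 * (x * x * x) < (1 + 2 * y) * (1 + 2 * y) →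
    x + 64 * (x * x * (x * x)) * (x * x * x)
      < 16 * (x * x) * ((1 + 2 * x * y) * (1 + 2 * x * y)) + 16 * (x * x * (x * x))
  Hall-bound-y²≤x³ {x} {y} hall@(nonZero , _) y²≤x³ 4x³<[1+2y]² with m≤n⇒∃[o]m+o≡n y²≤x³
  ... | m , y²+m≡x³ = bound-y²+m≡x³ {{nonZero}} y²+m≡x³ (sq<∧cube≤⇒m*x≤y m²<x (≤-reflexive (sym y²+m≡x³)))
    where
    m²<x : m * m < x
    m²<x = Hall⇒m*m<x hall (nearest-square-above {x ^ 3} {y} {m}
      (trans y²+m≡x³ (sym (x^3≡x*x*x x))) (gap≤-of-<[y+½]² {y = y} y²+m≡x³ 4x³<[1+2y]²))

  Hall-bound-x³≤y² : ∀ {x y} → IsHall x → x * x * x ≤ y * y → 4 * (y * y) + 1 < 4 * (x * x * x) + 4 * y →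
    16 * (x * x) + 64 * (x * x * (x * x)) * (y * y)
      < x + 16 * (x * x * (x * x)) + 64 * (x * x * (x * x)) * (x * x * x) + 64 * (x * x * x) * y
  Hall-bound-x³≤y² {x} {y} hall@(nonZero , _) x³≤y² 4y²+1<4x³+4y with m≤n⇒∃[o]m+o≡n x³≤y²
  ... | m , x³+m≡y² = bound-x³+m≡y² {{nonZero}} x³+m≡y² (sq<∧cube≤⇒m*x≤y m²<x (≤-trans x³≤y² (m≤m+n (y * y) m)))
    where
    m²<x : m * m < x
    m²<x = Hall⇒m*m<x hall (nearest-square-below {x ^ 3} {y} {m}
      (trans (cong (_+ m) (x^3≡x*x*x x)) x³+m≡y²) (gap<-of->[y-½]² {x * x * x} {y} x³+m≡y² 4y²+1<4x³+4y))

module RationalEmbedding where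

  import Data.Nat as ℕ
  import Data.Nat.Coprimality as Coprime
  open import Data.Integer as ℤ using (+_)
  import Data.Integer.Properties as ℤP
  open import Data.Rational as ℚ using (ℚ; mkℚ; 0ℚ; _/_; _+_; _*_; _-_; -_; _<_; *<*)
  import Data.Rational.Properties as ℚP
  open import Data.Rational.Solver using (module +-*-Solver)
  open +-*-Solver using (solve; _:+_; _:-_; _:=_)

  fromℕ : ℕ → ℚ
  fromℕ n = + n / 1

  fromℕ≡mkℚ : ∀ n → fromℕ n ≡ mkℚ (+ n) 0 (Coprime.sym (Coprime.1-coprimeTo n))
  fromℕ≡mkℚ n = ℚP.normalize-coprime (Coprime.sym (Coprime.1-coprimeTo n))

  fromℕ-+ : ∀ m n → fromℕ (m ℕ.+ n) ≡ fromℕ m + fromℕ n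
  fromℕ-+ m n rewrite fromℕ≡mkℚ m | fromℕ≡mkℚ n =
    cong (_/ 1) (trans (ℤP.pos-+ m n) (sym (cong₂ ℤ._+_ (ℤP.*-identityʳ (+ m)) (ℤP.*-identityʳ (+ n)))))

  fromℕ-* : ∀ m n → fromℕ (m ℕ.* n) ≡ fromℕ m * fromℕ n
  fromℕ-* m n rewrite fromℕ≡mkℚ m | fromℕ≡mkℚ n = cong (_/ 1) (ℤP.pos-* m n)

  fromℕ-mono-< : ∀ {m n} → m ℕ.< n → fromℕ m < fromℕ n
  fromℕ-mono-< {m} {n} m<n rewrite fromℕ≡mkℚ m | fromℕ≡mkℚ n =
    *<* (subst₂ ℤ._<_ (sym (ℤP.*-identityʳ (+ m))) (sym (ℤP.*-identityʳ (+ n))) (ℤ.+<+ m<n))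

  fromℕ-cancel-< : ∀ {m n} → fromℕ m < fromℕ n → m ℕ.< n
  fromℕ-cancel-< {m} {n} fm<fn rewrite fromℕ≡mkℚ m | fromℕ≡mkℚ n with fm<fn
  ... | *<* p with subst₂ ℤ._<_ (ℤP.*-identityʳ (+ m)) (ℤP.*-identityʳ (+ n)) p
  ... | ℤ.+<+ m<n = m<n

  0<p∧0<q⇒0<p*q : ∀ {p q} → 0ℚ < p → 0ℚ < q → 0ℚ < p * q
  0<p∧0<q⇒0<p*q {p} {q} 0<p 0<q =
    ℚP.positive⁻¹ (p * q) {{ℚP.pos*pos⇒pos p {{ℚ.positive 0<p}} q {{ℚ.positive 0<q}}}}

  infixl 6 _⊞_
  infixl 7 _⊠_

  data Poly : Set where
    vx vy   : Poly
    lit     : ℕ → Poly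
    _⊞_ _⊠_ : Poly → Poly → Poly

  module Evaluation (x y : ℕ) where

    ⟦_⟧ℕ : Poly → ℕ
    ⟦ vx ⟧ℕ    = x
    ⟦ vy ⟧ℕ    = y
    ⟦ lit n ⟧ℕ = n
    ⟦ p ⊞ q ⟧ℕ = ⟦ p ⟧ℕ ℕ.+ ⟦ q ⟧ℕ
    ⟦ p ⊠ q ⟧ℕ = ⟦ p ⟧ℕ ℕ.* ⟦ q ⟧ℕ

    ⟦_⟧ℚ : Poly → ℚ
    ⟦ vx ⟧ℚ    = fromℕ x
    ⟦ vy ⟧ℚ    = fromℕ y
    ⟦ lit n ⟧ℚ = fromℕ n
    ⟦ p ⊞ q ⟧ℚ = ⟦ p ⟧ℚ + ⟦ q ⟧ℚ
    ⟦ p ⊠ q ⟧ℚ = ⟦ p ⟧ℚ * ⟦ q ⟧ℚ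

    fromℕ-⟦⟧ : ∀ p → fromℕ ⟦ p ⟧ℕ ≡ ⟦ p ⟧ℚ
    fromℕ-⟦⟧ vx      = refl
    fromℕ-⟦⟧ vy      = refl
    fromℕ-⟦⟧ (lit n) = refl
    fromℕ-⟦⟧ (p ⊞ q) = trans (fromℕ-+ ⟦ p ⟧ℕ ⟦ q ⟧ℕ) (cong₂ _+_ (fromℕ-⟦⟧ p) (fromℕ-⟦⟧ q))
    fromℕ-⟦⟧ (p ⊠ q) = trans (fromℕ-* ⟦ p ⟧ℕ ⟦ q ⟧ℕ) (cong₂ _*_ (fromℕ-⟦⟧ p) (fromℕ-⟦⟧ q))

    -- A comparison a < b of rationals is moved to ℕ once an affine change K * _ + s with K > 0
    -- turns a and b into values of natural polynomials; s absorbs the negative terms.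
    <-toℕ : ∀ p q {K a b s} → 0ℚ < K →
            K * a + s ≡ ⟦ p ⟧ℚ → K * b + s ≡ ⟦ q ⟧ℚ → a < b → ⟦ p ⟧ℕ ℕ.< ⟦ q ⟧ℕ
    <-toℕ p q {K} {s = s} 0<K Ka+s≡p Kb+s≡q a<b = fromℕ-cancel-<
      (subst₂ _<_ (trans Ka+s≡p (sym (fromℕ-⟦⟧ p))) (trans Kb+s≡q (sym (fromℕ-⟦⟧ q)))
        (ℚP.+-monoˡ-< s (ℚP.*-monoʳ-<-pos K {{ℚ.positive 0<K}} a<b)))

    <-fromℕ : ∀ p q {K a b s} → 0ℚ < K →
              K * a + s ≡ ⟦ p ⟧ℚ → K * b + s ≡ ⟦ q ⟧ℚ → ⟦ p ⟧ℕ ℕ.< ⟦ q ⟧ℕ → a < b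
    <-fromℕ p q {K} {a} {b} {s} 0<K Ka+s≡p Kb+s≡q p<q =
      ℚP.*-cancelˡ-<-nonNeg K {{ℚ.nonNegative (ℚP.<⇒≤ 0<K)}}
        (subst₂ _<_ (+-s-cancel (K * a)) (+-s-cancel (K * b)) (ℚP.+-monoˡ-< (- s)
          (subst₂ _<_ (trans (fromℕ-⟦⟧ p) (sym Ka+s≡p)) (trans (fromℕ-⟦⟧ q) (sym Kb+s≡q)) (fromℕ-mono-< p<q))))
      where
      +-s-cancel : ∀ c → c + s - s ≡ c
      +-s-cancel c = solve 2 (λ c s → c :+ s :- s := c) refl c s

module QuadraticField {d : ℕ} where

  open import Data.Nat as ℕ using (NonZero)
  open import Data.Rational as ℚ using (ℚ; 0ℚ; 1ℚ; _*_; _-_; -_; _<_)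
  import Data.Rational.Properties as ℚP
  open import Data.Rational.Solver using (module +-*-Solver)
  open +-*-Solver using (solve; con; _:+_; _:*_; _:-_; :-_; _:=_)
  open RationalEmbedding using (fromℕ; fromℕ-mono-<; 0<p∧0<q⇒0<p*q)

  ⊖-identityʳ : (u : Q√ d) → u ⊖ nat 0 ≡ u
  ⊖-identityʳ (a ,√ b) = cong₂ _,√_ (ℚP.+-identityʳ a) (ℚP.+-identityʳ b)

  Positive-re<0 : ∀ {a b} → a < 0ℚ → Positive {d} (a ,√ b) → a * a < b * b * fromℕ d
  Positive-re<0 a<0 (inj₁ (0≤a , _))                = ⊥-elim (ℚP.<-irrefl refl (ℚP.<-≤-trans a<0 0≤a))
  Positive-re<0 a<0 (inj₂ (inj₁ (0<a , _)))         = ⊥-elim (ℚP.<-asym a<0 0<a)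
  Positive-re<0 a<0 (inj₂ (inj₂ (_ , _ , a²<b²d))) = a²<b²d

  Positive-im<0 : ∀ {a b} → b < 0ℚ → Positive {d} (a ,√ b) → b * b * fromℕ d < a * a
  Positive-im<0 b<0 (inj₁ (_ , 0≤b , _))            = ⊥-elim (ℚP.<-irrefl refl (ℚP.<-≤-trans b<0 0≤b))
  Positive-im<0 b<0 (inj₂ (inj₁ (_ , _ , b²d<a²))) = b²d<a²
  Positive-im<0 b<0 (inj₂ (inj₂ (_ , 0<b , _)))     = ⊥-elim (ℚP.<-asym b<0 0<b)

  nat⊗√d : ∀ n → nat {d} n ⊗ √d ≡ (0ℚ ,√ fromℕ n)
  nat⊗√d n = cong₂ _,√_
    (solve 2 (λ N D → N :* con 0ℚ :+ con 0ℚ :* con 1ℚ :* D := con 0ℚ) refl (fromℕ n) (fromℕ d))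
    (solve 1 (λ N → N :* con 1ℚ :+ con 0ℚ :* con 0ℚ := N) refl (fromℕ n))

  x√d≡y⊕f⇒ : ∀ {x y} {f : Q√ d} → nat x ⊗ √d ≡ nat y ⊕ f → f ≡ (- fromℕ y ,√ fromℕ x)
  x√d≡y⊕f⇒ {x} {y} {a ,√ b} x√d≡y⊕f = cong₂ _,√_
    (trans (solve 2 (λ a Y → a := Y :+ a :- Y) refl a Y)
      (trans (cong (_- Y) (sym (cong Q√.re 0+x√d≡y⊕f))) (ℚP.+-identityˡ (- Y))))
    (trans (sym (ℚP.+-identityˡ b)) (sym (cong Q√.im 0+x√d≡y⊕f)))
    where
    Y : ℚ
    Y = fromℕ y
    0+x√d≡y⊕f : (0ℚ ,√ fromℕ x) ≡ nat y ⊕ (a ,√ b)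
    0+x√d≡y⊕f = trans (sym (nat⊗√d x)) x√d≡y⊕f

  x√d≡y⊖f⇒ : ∀ {x y} {f : Q√ d} → nat x ⊗ √d ≡ nat y ⊖ f → f ≡ (fromℕ y ,√ - fromℕ x)
  x√d≡y⊖f⇒ {x} {y} {a ,√ b} x√d≡y⊖f = cong₂ _,√_
    (trans (solve 2 (λ a Y → a := Y :- (Y :- a)) refl a Y)
      (trans (cong (λ t → Y - t) (sym (cong Q√.re 0+x√d≡y⊖f))) (ℚP.+-identityʳ Y)))
    (trans (solve 1 (λ b → b := :- (con 0ℚ :- b)) refl b) (cong -_ (sym (cong Q√.im 0+x√d≡y⊖f))))
    where
    Y : ℚ
    Y = fromℕ y
    0+x√d≡y⊖f : (0ℚ ,√ fromℕ x) ≡ nat y ⊖ (a ,√ b)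
    0+x√d≡y⊖f = trans (sym (nat⊗√d x)) x√d≡y⊖f

  1+c√d⊖2fx : ∀ c a b x →
    (nat {d} 1 ⊕ (0ℚ ,√ c)) ⊖ (nat 2 ⊗ (a ,√ b) ⊗ nat x) ≡ (1ℚ - fromℕ 2 * a * fromℕ x ,√ c - fromℕ 2 * b * fromℕ x)
  1+c√d⊖2fx c a b x = cong₂ _,√_
    (solve 4 (λ a b X D → (con 1ℚ :+ con 0ℚ) :- ((con (fromℕ 2) :* a :+ con 0ℚ :* b :* D) :* X :+ (con (fromℕ 2) :* b :+ con 0ℚ :* a) :* con 0ℚ :* D)
                        := con 1ℚ :- con (fromℕ 2) :* a :* X) refl a b (fromℕ x) (fromℕ d))
    (solve 5 (λ a b c X D → (con 0ℚ :+ c) :- ((con (fromℕ 2) :* a :+ con 0ℚ :* b :* D) :* con 0ℚ :+ (con (fromℕ 2) :* b :+ con 0ℚ :* a) :* X)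
                          := c :- con (fromℕ 2) :* b :* X) refl a b c (fromℕ x) (fromℕ d))

  recip-im : ∀ {b} → .{{NonZero d}} → 0ℚ < b →
             ∃ λ c → recip {d} (0ℚ ,√ b) ≡ (0ℚ ,√ c) × c * (b * fromℕ d) ≡ 1ℚ
  recip-im {b} 0<b with 0ℚ * 0ℚ - b * b * fromℕ d ℚP.≟ 0ℚ
  ... | yes D≡0 = ⊥-elim (ℚP.<-irrefl (sym b²d≡0) 0<b²d)
    where
    0<b²d : 0ℚ < b * b * fromℕ d
    0<b²d = 0<p∧0<q⇒0<p*q (0<p∧0<q⇒0<p*q 0<b 0<b) (fromℕ-mono-< (ℕ.>-nonZero⁻¹ d))
    b²d≡0 : b * b * fromℕ d ≡ 0ℚ
    b²d≡0 = trans (solve 2 (λ b D → b :* b :* D := con 0ℚ :- (con 0ℚ :* con 0ℚ :- b :* b :* D)) refl b (fromℕ d))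
                  (cong (λ t → 0ℚ - t) D≡0)
  ... | no D≢0 = - (b * ℚ.1/ D) , cong (_,√ - (b * ℚ.1/ D)) (ℚP.*-zeroˡ (ℚ.1/ D)) , c*bd≡1
    where
    D : ℚ
    D = 0ℚ * 0ℚ - b * b * fromℕ d
    instance
      D-nonZero : ℚ.NonZero D
      D-nonZero = ℚ.≢-nonZero D≢0
    c*bd≡1 : - (b * ℚ.1/ D) * (b * fromℕ d) ≡ 1ℚ
    c*bd≡1 = trans (solve 3 (λ b i D → :- (b :* i) :* (b :* D) := i :* (con 0ℚ :* con 0ℚ :- b :* b :* D)) refl b (ℚ.1/ D) (fromℕ d))
                   (ℚP.*-inverseˡ D)

  2fd≺1+recip[4√d] : .{{NonZero d}} → ∀ {f a b} → f ≡ (a ,√ b) →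
    (∀ c → c * (fromℕ 4 * fromℕ d) ≡ 1ℚ → Positive {d} (1ℚ - fromℕ 2 * a * fromℕ d ,√ c - fromℕ 2 * b * fromℕ d)) →
    nat 2 ⊗ f ⊗ nat d ≺ nat 1 ⊕ recip (nat 4 ⊗ √d)
  2fd≺1+recip[4√d] {f} {a} {b} f≡ab positive-components =
    let c , recip≡ , c4d≡1 = recip-im {fromℕ 4} (fromℕ-mono-< {0} {4} ℕ.z<s) in
    subst (λ (r , g) → Positive {d} ((nat 1 ⊕ r) ⊖ (nat 2 ⊗ g ⊗ nat d)))
      (sym (cong₂ _,_ (trans (cong recip (nat⊗√d 4)) recip≡) f≡ab))
      (subst Positive (sym (1+c√d⊖2fx c a b d)) (positive-components c c4d≡1))

module HallCases (x y : ℕ) where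

  import Data.Nat as ℕ
  import Data.Nat.Properties as ℕP
  open import Data.Rational as ℚ using (ℚ; 0ℚ; 1ℚ; ½; _+_; _*_; _-_; -_; _<_)
  import Data.Rational.Properties as ℚP
  open import Data.Rational.Solver using (module +-*-Solver)
  open +-*-Solver using (solve; con; _:+_; _:*_; _:-_; :-_; _:=_)
  open HallBounds using (Hall-bound-y²≤x³; Hall-bound-x³≤y²; 1<8*x³)
  open RationalEmbedding
  open Evaluation x y
  open QuadraticField using (Positive-re<0; Positive-im<0)

  private
    X Y : ℚ
    X = fromℕ x
    Y = fromℕ y
    0<1 : 0ℚ < 1ℚ
    0<1 = fromℕ-mono-< {0} {1} ℕ.z<s

  case-x√x≡y+f : IsHall x → 0 ℕ.< y → (c : ℚ) → c * (fromℕ 4 * X) ≡ 1ℚ →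
    Positive {x} (- Y ,√ X) → Positive {x} (½ - - Y ,√ 0ℚ - X) →
    Positive {x} (1ℚ - fromℕ 2 * - Y * X ,√ c - fromℕ 2 * X * X)
  case-x√x≡y+f hall 0<y c c4x≡1 0<f f<½ = inj₂ (inj₁ (0<re , im<0 , im²x<re²))
    where
    0<x : 0 ℕ.< x
    0<x = ℕ.>-nonZero⁻¹ x {{proj₁ hall}}
    y²<x³ : y ℕ.* y ℕ.< x ℕ.* x ℕ.* x
    y²<x³ = <-toℕ (vy ⊠ vy) (vx ⊠ vx ⊠ vx) 0<1
      (solve 1 (λ Y → con 1ℚ :* (:- Y :* :- Y) :+ con 0ℚ := Y :* Y) refl (Y))
      (solve 1 (λ X → con 1ℚ :* (X :* X :* X) :+ con 0ℚ := X :* X :* X) refl (X))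
      (Positive-re<0 {x} (ℚP.neg-antimono-< (fromℕ-mono-< 0<y)) 0<f)
    x³<[y+½]² : 4 ℕ.* (x ℕ.* x ℕ.* x) ℕ.< (1 ℕ.+ 2 ℕ.* y) ℕ.* (1 ℕ.+ 2 ℕ.* y)
    x³<[y+½]² = <-toℕ (lit 4 ⊠ (vx ⊠ vx ⊠ vx)) ((lit 1 ⊞ lit 2 ⊠ vy) ⊠ (lit 1 ⊞ lit 2 ⊠ vy)) (fromℕ-mono-< {0} {4} ℕ.z<s)
      (solve 1 (λ X → con (fromℕ 4) :* ((con 0ℚ :- X) :* (con 0ℚ :- X) :* X) :+ con 0ℚ := con (fromℕ 4) :* (X :* X :* X)) refl (X))
      (solve 1 (λ Y → con (fromℕ 4) :* ((con ½ :- :- Y) :* (con ½ :- :- Y)) :+ con 0ℚ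
                   := (con (fromℕ 1) :+ con (fromℕ 2) :* Y) :* (con (fromℕ 1) :+ con (fromℕ 2) :* Y)) refl (Y))
      (Positive-im<0 {x} (<-fromℕ (lit 0) vx 0<1
         (solve 1 (λ X → con 1ℚ :* (con 0ℚ :- X) :+ X := con (fromℕ 0)) refl (X))
         (solve 1 (λ X → con 1ℚ :* con 0ℚ :+ X := X) refl (X)) 0<x) f<½)
    -- 4x c = 1, so scaling by 4x (and by (4x)² for squares) eliminates c.
    4x*im≡1-8x³ : fromℕ 4 * X * (c - fromℕ 2 * X * X) ≡ 1ℚ - fromℕ 8 * (X * X * X)
    4x*im≡1-8x³ = trans
      (solve 2 (λ c X → con (fromℕ 4) :* X :* (c :- con (fromℕ 2) :* X :* X) := c :* (con (fromℕ 4) :* X) :- con (fromℕ 8) :* (X :* X :* X)) refl c (X))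
      (cong (λ u → u - fromℕ 8 * (X * X * X)) c4x≡1)
    0<re : 0ℚ < 1ℚ - fromℕ 2 * - Y * X
    0<re = <-fromℕ (lit 0) (lit 1 ⊞ lit 2 ⊠ vx ⊠ vy) 0<1
      (solve 0 (con 1ℚ :* con 0ℚ :+ con 0ℚ := con (fromℕ 0)) refl)
      (solve 2 (λ X Y → con 1ℚ :* (con 1ℚ :- con (fromℕ 2) :* :- Y :* X) :+ con 0ℚ := con (fromℕ 1) :+ con (fromℕ 2) :* X :* Y) refl (X) (Y))
      ℕ.z<s
    im<0 : c - fromℕ 2 * X * X < 0ℚ
    im<0 = <-fromℕ (lit 1) (lit 8 ⊠ (vx ⊠ vx ⊠ vx)) (0<p∧0<q⇒0<p*q (fromℕ-mono-< {0} {4} ℕ.z<s) (fromℕ-mono-< 0<x))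
      (trans (cong (_+ fromℕ 8 * (X * X * X)) 4x*im≡1-8x³)
             (solve 1 (λ X → con 1ℚ :- con (fromℕ 8) :* (X :* X :* X) :+ con (fromℕ 8) :* (X :* X :* X) := con (fromℕ 1)) refl (X)))
      (solve 1 (λ X → con (fromℕ 4) :* X :* con 0ℚ :+ con (fromℕ 8) :* (X :* X :* X) := con (fromℕ 8) :* (X :* X :* X)) refl (X))
      (1<8*x³ x {{proj₁ hall}})
    im²x<re² : (c - fromℕ 2 * X * X) * (c - fromℕ 2 * X * X) * X < (1ℚ - fromℕ 2 * - Y * X) * (1ℚ - fromℕ 2 * - Y * X)
    im²x<re² = <-fromℕ (vx ⊞ lit 64 ⊠ (vx ⊠ vx ⊠ (vx ⊠ vx)) ⊠ (vx ⊠ vx ⊠ vx))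
                       (lit 16 ⊠ (vx ⊠ vx) ⊠ ((lit 1 ⊞ lit 2 ⊠ vx ⊠ vy) ⊠ (lit 1 ⊞ lit 2 ⊠ vx ⊠ vy)) ⊞ lit 16 ⊠ (vx ⊠ vx ⊠ (vx ⊠ vx)))
      (0<p∧0<q⇒0<p*q (fromℕ-mono-< {0} {16} ℕ.z<s) (0<p∧0<q⇒0<p*q (fromℕ-mono-< 0<x) (fromℕ-mono-< 0<x)))
      (trans (solve 2 (λ c X → con (fromℕ 16) :* (X :* X) :* ((c :- con (fromℕ 2) :* X :* X) :* (c :- con (fromℕ 2) :* X :* X) :* X) :+ con (fromℕ 16) :* (X :* X :* (X :* X))
                            := (con (fromℕ 4) :* X :* (c :- con (fromℕ 2) :* X :* X)) :* (con (fromℕ 4) :* X :* (c :- con (fromℕ 2) :* X :* X)) :* X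
                               :+ con (fromℕ 16) :* (X :* X :* (X :* X))) refl c (X))
      (trans (cong (λ u → u * u * X + fromℕ 16 * (X * X * (X * X))) 4x*im≡1-8x³)
             (solve 1 (λ X → (con 1ℚ :- con (fromℕ 8) :* (X :* X :* X)) :* (con 1ℚ :- con (fromℕ 8) :* (X :* X :* X)) :* X :+ con (fromℕ 16) :* (X :* X :* (X :* X))
                          := X :+ con (fromℕ 64) :* (X :* X :* (X :* X)) :* (X :* X :* X)) refl (X))))
      (solve 2 (λ X Y → con (fromℕ 16) :* (X :* X) :* ((con 1ℚ :- con (fromℕ 2) :* :- Y :* X) :* (con 1ℚ :- con (fromℕ 2) :* :- Y :* X)) :+ con (fromℕ 16) :* (X :* X :* (X :* X))
                     := con (fromℕ 16) :* (X :* X) :* ((con (fromℕ 1) :+ con (fromℕ 2) :* X :* Y) :* (con (fromℕ 1) :+ con (fromℕ 2) :* X :* Y))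
                        :+ con (fromℕ 16) :* (X :* X :* (X :* X))) refl (X) (Y))
      (Hall-bound-y²≤x³ hall (ℕP.<⇒≤ y²<x³) x³<[y+½]²)

  case-x√x≡y-f : IsHall x → 0 ℕ.< y → (c : ℚ) → c * (fromℕ 4 * X) ≡ 1ℚ →
    Positive {x} (Y ,√ - X) → Positive {x} (½ - Y ,√ 0ℚ - - X) →
    Positive {x} (1ℚ - fromℕ 2 * Y * X ,√ c - fromℕ 2 * - X * X)
  case-x√x≡y-f hall 0<y c c4x≡1 0<f f<½ = inj₂ (inj₂ (re<0 , 0<im , re²<im²x))
    where
    0<x : 0 ℕ.< x
    0<x = ℕ.>-nonZero⁻¹ x {{proj₁ hall}}
    1<2y : 1 ℕ.< 2 ℕ.* y
    1<2y = ℕP.*-monoʳ-≤ 2 0<y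
    x³<y² : x ℕ.* x ℕ.* x ℕ.< y ℕ.* y
    x³<y² = <-toℕ (vx ⊠ vx ⊠ vx) (vy ⊠ vy) 0<1
      (solve 1 (λ X → con 1ℚ :* (:- X :* :- X :* X) :+ con 0ℚ := X :* X :* X) refl (X))
      (solve 1 (λ Y → con 1ℚ :* (Y :* Y) :+ con 0ℚ := Y :* Y) refl (Y))
      (Positive-im<0 {x} (ℚP.neg-antimono-< (fromℕ-mono-< 0<x)) 0<f)
    [y-½]²<x³ : 4 ℕ.* (y ℕ.* y) ℕ.+ 1 ℕ.< 4 ℕ.* (x ℕ.* x ℕ.* x) ℕ.+ 4 ℕ.* y
    [y-½]²<x³ = <-toℕ (lit 4 ⊠ (vy ⊠ vy) ⊞ lit 1) (lit 4 ⊠ (vx ⊠ vx ⊠ vx) ⊞ lit 4 ⊠ vy) (fromℕ-mono-< {0} {4} ℕ.z<s)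
      (solve 1 (λ Y → con (fromℕ 4) :* ((con ½ :- Y) :* (con ½ :- Y)) :+ con (fromℕ 4) :* Y := con (fromℕ 4) :* (Y :* Y) :+ con (fromℕ 1)) refl (Y))
      (solve 2 (λ X Y → con (fromℕ 4) :* ((con 0ℚ :- :- X) :* (con 0ℚ :- :- X) :* X) :+ con (fromℕ 4) :* Y
                     := con (fromℕ 4) :* (X :* X :* X) :+ con (fromℕ 4) :* Y) refl (X) (Y))
      (Positive-re<0 {x} (<-fromℕ (lit 1) (lit 2 ⊠ vy) (fromℕ-mono-< {0} {2} ℕ.z<s)
         (solve 1 (λ Y → con (fromℕ 2) :* (con ½ :- Y) :+ con (fromℕ 2) :* Y := con (fromℕ 1)) refl (Y))
         (solve 1 (λ Y → con (fromℕ 2) :* con 0ℚ :+ con (fromℕ 2) :* Y := con (fromℕ 2) :* Y) refl (Y)) 1<2y) f<½)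
    4x*im≡1+8x³ : fromℕ 4 * X * (c - fromℕ 2 * - X * X) ≡ 1ℚ + fromℕ 8 * (X * X * X)
    4x*im≡1+8x³ = trans
      (solve 2 (λ c X → con (fromℕ 4) :* X :* (c :- con (fromℕ 2) :* :- X :* X) := c :* (con (fromℕ 4) :* X) :+ con (fromℕ 8) :* (X :* X :* X)) refl c (X))
      (cong (_+ fromℕ 8 * (X * X * X)) c4x≡1)
    re<0 : 1ℚ - fromℕ 2 * Y * X < 0ℚ
    re<0 = <-fromℕ (lit 1) (lit 2 ⊠ vx ⊠ vy) 0<1
      (solve 2 (λ X Y → con 1ℚ :* (con 1ℚ :- con (fromℕ 2) :* Y :* X) :+ con (fromℕ 2) :* X :* Y := con (fromℕ 1)) refl (X) (Y))
      (solve 2 (λ X Y → con 1ℚ :* con 0ℚ :+ con (fromℕ 2) :* X :* Y := con (fromℕ 2) :* X :* Y) refl (X) (Y))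
      (ℕP.<-≤-trans 1<2y (ℕP.*-monoˡ-≤ y (ℕP.m≤m*n 2 x {{proj₁ hall}})))
    0<im : 0ℚ < c - fromℕ 2 * - X * X
    0<im = <-fromℕ (lit 0) (lit 1 ⊞ lit 8 ⊠ (vx ⊠ vx ⊠ vx)) (0<p∧0<q⇒0<p*q (fromℕ-mono-< {0} {4} ℕ.z<s) (fromℕ-mono-< 0<x))
      (solve 1 (λ X → con (fromℕ 4) :* X :* con 0ℚ :+ con 0ℚ := con (fromℕ 0)) refl (X))
      (trans (ℚP.+-identityʳ _) 4x*im≡1+8x³)
      ℕ.z<s
    re²<im²x : (1ℚ - fromℕ 2 * Y * X) * (1ℚ - fromℕ 2 * Y * X) < (c - fromℕ 2 * - X * X) * (c - fromℕ 2 * - X * X) * X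
    re²<im²x = <-fromℕ (lit 16 ⊠ (vx ⊠ vx) ⊞ lit 64 ⊠ (vx ⊠ vx ⊠ (vx ⊠ vx)) ⊠ (vy ⊠ vy))
                       (vx ⊞ lit 16 ⊠ (vx ⊠ vx ⊠ (vx ⊠ vx)) ⊞ lit 64 ⊠ (vx ⊠ vx ⊠ (vx ⊠ vx)) ⊠ (vx ⊠ vx ⊠ vx) ⊞ lit 64 ⊠ (vx ⊠ vx ⊠ vx) ⊠ vy)
      (0<p∧0<q⇒0<p*q (fromℕ-mono-< {0} {16} ℕ.z<s) (0<p∧0<q⇒0<p*q (fromℕ-mono-< 0<x) (fromℕ-mono-< 0<x)))
      (solve 2 (λ X Y → con (fromℕ 16) :* (X :* X) :* ((con 1ℚ :- con (fromℕ 2) :* Y :* X) :* (con 1ℚ :- con (fromℕ 2) :* Y :* X)) :+ con (fromℕ 64) :* (X :* X :* X) :* Y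
                     := con (fromℕ 16) :* (X :* X) :+ con (fromℕ 64) :* (X :* X :* (X :* X)) :* (Y :* Y)) refl (X) (Y))
      (trans (solve 3 (λ c X Y → con (fromℕ 16) :* (X :* X) :* ((c :- con (fromℕ 2) :* :- X :* X) :* (c :- con (fromℕ 2) :* :- X :* X) :* X) :+ con (fromℕ 64) :* (X :* X :* X) :* Y
                              := (con (fromℕ 4) :* X :* (c :- con (fromℕ 2) :* :- X :* X)) :* (con (fromℕ 4) :* X :* (c :- con (fromℕ 2) :* :- X :* X)) :* X
                                 :+ con (fromℕ 64) :* (X :* X :* X) :* Y) refl c (X) (Y))
      (trans (cong (λ u → u * u * X + fromℕ 64 * (X * X * X) * Y) 4x*im≡1+8x³)
             (solve 2 (λ X Y → (con 1ℚ :+ con (fromℕ 8) :* (X :* X :* X)) :* (con 1ℚ :+ con (fromℕ 8) :* (X :* X :* X)) :* X :+ con (fromℕ 64) :* (X :* X :* X) :* Y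
                            := X :+ con (fromℕ 16) :* (X :* X :* (X :* X)) :+ con (fromℕ 64) :* (X :* X :* (X :* X)) :* (X :* X :* X)
                               :+ con (fromℕ 64) :* (X :* X :* X) :* Y) refl (X) (Y))))
      (Hall-bound-x³≤y² hall (ℕP.<⇒≤ x³<y²) [y-½]²<x³)

open import Data.Nat using (_<_)
open import Data.Rational using (½; -_)
open RationalEmbedding using (fromℕ)
open QuadraticField using (x√d≡y⊕f⇒; x√d≡y⊖f⇒; ⊖-identityʳ; 2fd≺1+recip[4√d])

lemma3 : (x : ℕ) → IsHall x → (y : ℕ) → 0 < y → (f : Q√ x) →
         (nat x ⊗ √d ≡ nat y ⊕ f ⊎ nat x ⊗ √d ≡ nat y ⊖ f) →
         nat 0 ≺ f → f ≺ rat ½ →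
         nat 2 ⊗ f ⊗ nat x ≺ nat 1 ⊕ recip (nat 4 ⊗ √d)
lemma3 x hall y 0<y f (inj₁ x√x≡y+f) 0<f f<½ =
  2fd≺1+recip[4√d] {{proj₁ hall}} f≡ λ c c4x≡1 →
    HallCases.case-x√x≡y+f x y hall 0<y c c4x≡1
      (subst Positive (trans (cong (_⊖ nat 0) f≡) (⊖-identityʳ _)) 0<f)
      (subst (λ g → Positive (rat ½ ⊖ g)) f≡ f<½)
  where
  f≡ : f ≡ (- fromℕ y ,√ fromℕ x)
  f≡ = x√d≡y⊕f⇒ {x = x} {y = y} x√x≡y+f
lemma3 x hall y 0<y f (inj₂ x√x≡y-f) 0<f f<½ =
  2fd≺1+recip[4√d] {{proj₁ hall}} f≡ λ c c4x≡1 →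
    HallCases.case-x√x≡y-f x y hall 0<y c c4x≡1
      (subst Positive (trans (cong (_⊖ nat 0) f≡) (⊖-identityʳ _)) 0<f)
      (subst (λ g → Positive (rat ½ ⊖ g)) f≡ f<½)
  where
  f≡ : f ≡ (fromℕ y ,√ - fromℕ x)
  f≡ = x√d≡y⊖f⇒ {x = x} {y = y} x√x≡y-f
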